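{- Let $m\geqslant 3$, $n\geqslant 3$ be odd integers and let $M\geqslant m$, $N\geqslant n$ be odd integers. Then the labelings $\mathrm{HALL}_{M,N}(m,n)$ and $\mathrm{VALL}_{M,N}(m,n)$ are partial bicentrally balanced $C_4$-face-magic labelings on the $m\times n$ subgrid of $\mathcal{P}_{M,N}$.
   Context: Write $m=2m_0+1$, $n=2n_0+1$, $m_0^{+}=m_0+1$, $n_0^{+}=n_0+1$. $\mathrm{Grid}(m,n)=\{(i,j):1\leqslant i\leqslant m,1\leqslant j\leqslant n\}$, and $P_m\times P_n$ is the planar $m\times n$ grid graph on it (edges $(i,j)$–$(i+1,j)$ and $(i,j)$–$(i,j+1)$), whose 4-cycle faces are $\{(i,j),(i+1,j),(i,j+1),(i+1,j+1)\}$, $1\leqslant i\leqslant m-1$, $1\leqslant j\leqslant n-1$. A labeling $X=\{x_{i,j}:(i,j)\in\mathrm{Grid}(m,n)\}$ is a partial bicentrally balanced $C_4$-face-magic labeling on the $m\times n$ subgrid of $\mathcal{P}_{M,N}$ if: (1) every 4-cycle face of $P_m\times P_n$ has label sum $2MN+3$; (2) $\{x_{i,j}: i+j \text{ even}\}=\{1,2,\ldots,\tfrac12 mn+\tfrac12\}$; (3) $\{x_{i,j}: i+j\text{ odd}\}=\{MN-\tfrac12 mn+\tfrac32, MN-\tfrac12 mn+\tfrac52,\ldots,MN\}$; (4) $x_{i,j}+x_{m+1-i,n+1-j}=\tfrac12 mn+\tfrac32$ if $i+j$ is even; (5) $x_{i,j}+x_{m+1-i,n+1-j}=2MN-\tfrac12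 mn+\tfrac32$ if $i+j$ is odd; (6) $x_{i,n_0^{+}}<x_{i+2,n_0^{+}}$ for $1\leqslant i\leqslant m-2$ with $i+n_0^{+}$ even, $x_{i,n_0^{+}}>x_{i+2,n_0^{+}}$ for $1\leqslant i\leqslant m-2$ with $i+n_0^{+}$ odd, $x_{m_0^{+},j}<x_{m_0^{+},j+2}$ for $1\leqslant j\leqslant n-2$ with $m_0^{+}+j$ even, and $x_{m_0^{+},j}>x_{m_0^{+},j+2}$ for $1\leqslant j\leqslant n-2$ with $m_0^{+}+j$ odd. $\mathrm{HALL}_{M,N}(m,n)=\{x_{i,j}\}$ is given by: $x_{2i-1,2j-1}=m(j-1)+i$ ($1\leqslant i\leqslant m_0^{+}$, $1\leqslant j\leqslant n_0^{+}$); $x_{2i,2j}=m(j-1)+m_0^{+}+i$ ($1\leqslant i\leqslant m_0$, $1\leqslant j\leqslant n_0$); $x_{2i,2j-1}=MN+m(1-j)+1-i$ ($1\leqslant i\leqslant m_0$, $1\leqslant j\leqslant n_0^{+}$); $x_{2i-1,2j}=MN-mj+m_0^{+}+1-i$ ($1\leqslant i\leqslant m_0^{+}$, $1\leqslant j\leqslant n_0$). $\mathrm{VALL}_{M,N}(m,n)=\{y_{i,j}\}$ is given by: $y_{2i-1,2j-1}=n(i-1)+j$ ($1\leqslant i\leqslant m_0^{+}$, $1\leqslant j\leqslant n_0^{+}$); $y_{2i,2j}=n(i-1)+n_0^{+}+j$ ($1\leqslant i\leqslant m_0$, $1\leqslant j\leqslant n_0$); $y_{2i,2j-1}=MN-ni+n_0^{+}+1-j$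 ($1\leqslant i\leqslant m_0$, $1\leqslant j\leqslant n_0^{+}$); $y_{2i-1,2j}=MN+n(1-i)+1-j$ ($1\leqslant i\leqslant m_0^{+}$, $1\leqslant j\leqslant n_0$). -}

module Defs where

open import Data.Nat as ℕ using (ℕ; suc; _/_; _%_)
open import Data.Integer as ℤ using (ℤ; +_; _+_; _-_; _*_; _<_; _≤_)
open import Data.Product using (_×_; ∃; ∃-syntax)
open import Relation.Binary.PropositionalEquality using (_≡_)

InGrid : ℕ → ℕ → ℕ → ℕ → Set
InGrid m n i j = (1 ℕ.≤ i × i ℕ.≤ m) × (1 ℕ.≤ j × j ℕ.≤ n)

Even : ℕ → Set
Even k = k % 2 ≡ 0

Odd : ℕ → Set
Odd k = k % 2 ≡ 1

-- "half index": for odd i = 2i'-1 or even i = 2i', this is i'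
hf : ℕ → ℕ
hf i = (i ℕ.+ 1) / 2

half : ℕ → ℕ
half m = m / 2

hmn : ℕ → ℕ → ℕ
hmn m n = (m ℕ.* n ℕ.+ 1) / 2

-- labelings are functions on grid coordinates (only values on Grid(m,n) matter)
Labeling : Set
Labeling = ℕ → ℕ → ℤ

HALL : ℕ → ℕ → ℕ → ℕ → Labeling
HALL M N m n i j with i % 2 | j % 2
... | 1 | 1 = (+ m) * (+ hf j - + 1) + + hf i
... | 0 | 0 = (+ m) * (+ hf j - + 1) + + suc (half m) + + hf i
... | 0 | _ = + (M ℕ.* N) + (+ m) * (+ 1 - + hf j) + + 1 - + hf i
... | _ | _ = + (M ℕ.* N) - (+ m) * (+ hf j) + + suc (half m) + + 1 - + hf i

VALL : ℕ → ℕ → ℕ → ℕ → Labeling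
VALL M N m n i j with i % 2 | j % 2
... | 1 | 1 = (+ n) * (+ hf i - + 1) + + hf j
... | 0 | 0 = (+ n) * (+ hf i - + 1) + + suc (half n) + + hf j
... | 0 | _ = + (M ℕ.* N) - (+ n) * (+ hf i) + + suc (half n) + + 1 - + hf j
... | _ | _ = + (M ℕ.* N) + (+ n) * (+ 1 - + hf i) + + 1 - + hf j

record PartialBicentrallyBalanced (M N m n : ℕ) (x : Labeling) : Set where
  field
    face : ∀ i j → 1 ℕ.≤ i → i ℕ.≤ m ℕ.∸ 1 → 1 ℕ.≤ j → j ℕ.≤ n ℕ.∸ 1 →
           x i j + x (suc i) j + x i (suc j) + x (suc i) (suc j)
             ≡ + (2 ℕ.* (M ℕ.* N) ℕ.+ 3)
    evenIn : ∀ i j → InGrid m n i j → Even (i ℕ.+ j) →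
             (+ 1 ≤ x i j) × (x i j ≤ + hmn m n)
    evenOnto : ∀ (k : ℤ) → + 1 ≤ k → k ≤ + hmn m n →
               ∃[ i ] ∃[ j ] (InGrid m n i j × Even (i ℕ.+ j) × x i j ≡ k)
    oddIn : ∀ i j → InGrid m n i j → Odd (i ℕ.+ j) →
            (+ (M ℕ.* N) - + hmn m n + + 2 ≤ x i j) × (x i j ≤ + (M ℕ.* N))
    oddOnto : ∀ (k : ℤ) → + (M ℕ.* N) - + hmn m n + + 2 ≤ k → k ≤ + (M ℕ.* N) →
              ∃[ i ] ∃[ j ] (InGrid m n i j × Odd (i ℕ.+ j) × x i j ≡ k)
    symEven : ∀ i j → InGrid m n i j → Even (i ℕ.+ j) →
              x i j + x (suc m ℕ.∸ i) (suc n ℕ.∸ j) ≡ + hmn m n + + 1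
    symOdd : ∀ i j → InGrid m n i j → Odd (i ℕ.+ j) →
             x i j + x (suc m ℕ.∸ i) (suc n ℕ.∸ j)
               ≡ + (2 ℕ.* (M ℕ.* N)) - + hmn m n + + 2
    colEven : ∀ i → 1 ℕ.≤ i → i ℕ.≤ m ℕ.∸ 2 → Even (i ℕ.+ suc (half n)) →
              x i (suc (half n)) < x (i ℕ.+ 2) (suc (half n))
    colOdd : ∀ i → 1 ℕ.≤ i → i ℕ.≤ m ℕ.∸ 2 → Odd (i ℕ.+ suc (half n)) →
             x (i ℕ.+ 2) (suc (half n)) < x i (suc (half n))
    rowEven : ∀ j → 1 ℕ.≤ j → j ℕ.≤ n ℕ.∸ 2 → Even (suc (half m) ℕ.+ j) →
              x (suc (half m)) j < x (suc (half m)) (j ℕ.+ 2)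
    rowOdd : ∀ j → 1 ℕ.≤ j → j ℕ.≤ n ℕ.∸ 2 → Odd (suc (half m) ℕ.+ j) →
             x (suc (half m)) (j ℕ.+ 2) < x (suc (half m)) j

-- Number the cells of the odd m × n grid in column-major order, L = (i - 1) + m (j - 1).
-- As m is odd, L has the parity of i + j, and HALL is the checkerboard enumeration of
-- these positions: position 2k is labelled k + 1 and position 2k + 1 is labelled MN - k.
-- Every condition is then a property of this enumeration. A face covers the positions
-- L, L + 1, L + m, L + m + 1: two consecutive pairs, one starting at an even and one at
-- an odd position (m is odd), whose sums are MN + 1 and MN + 2. The cell opposite the
-- centre has position mn - 1 - L, of the same parity as L. Two steps down a column or
-- along a row add 2 or 2m to L, and L ↦ (L mod m, L div m) inverts the numbering.
-- VALL is HALL of the transposed grid, and the conditions are symmetric under transposition.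

module Submission where

open import Defs
open import Data.Nat using (ℕ; _≤_)
open import Data.Product using (_×_)

open import Data.Nat as ℕ using (zero; suc; _<_; _%_; _/_; _∸_; z≤n; s≤s)
import Data.Nat.Properties as ℕₚ
open import Data.Nat.DivMod
  using (m*n%n≡0; m*n/n≡m; [m+kn]%n≡m%n; +-distrib-/-∣ʳ; m%n<n; m<n*o⇒m/o<n; m≡m%n+[m/n]*n)
open import Data.Nat.Divisibility using (n∣m*n)
import Data.Nat.Tactic.RingSolver as ℕ-Ring
open import Data.Integer as ℤ using (ℤ; +_; +≤+; +<+)
import Data.Integer.Properties as ℤₚ
open import Data.Integer.Tactic.RingSolver using (solve-∀; solve)
open import Data.List using (_∷_; [])
open import Data.Product using (_,_; ∃-syntax; swap)
open import Data.Empty using (⊥-elim)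
open import Function using (_∘_)
open import Relation.Binary.PropositionalEquality


data Halving : ℕ → Set where
  even : ∀ k → Halving (k ℕ.* 2)
  odd  : ∀ k → Halving (suc (k ℕ.* 2))

halving : ∀ n → Halving n
halving zero = even 0
halving (suc n) with halving n
... | even k = odd k
... | odd k  = even (suc k)

double+1%2 : ∀ k → suc (k ℕ.* 2) % 2 ≡ 1
double+1%2 k = [m+kn]%n≡m%n 1 k 2

double+1/2 : ∀ k → suc (k ℕ.* 2) / 2 ≡ k
double+1/2 k = trans (+-distrib-/-∣ʳ 1 {d = 2} (n∣m*n k)) (m*n/n≡m k 2)

double+1%2≢0 : ∀ k → suc (k ℕ.* 2) % 2 ≢ 0
double+1%2≢0 k e with () ← trans (sym (double+1%2 k)) e

double%2≢1 : ∀ k → k ℕ.* 2 % 2 ≢ 1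
double%2≢1 k e with () ← trans (sym (m*n%n≡0 k 2)) e

double≢double+1 : ∀ k l → k ℕ.* 2 ≢ suc (l ℕ.* 2)
double≢double+1 k l e = double+1%2≢0 l (trans (cong (_% 2) (sym e)) (m*n%n≡0 k 2))

double+double+1 : ∀ k a → k ℕ.* 2 ℕ.+ suc (a ℕ.* 2) ≡ suc ((k ℕ.+ a) ℕ.* 2)
double+double+1 = ℕ-Ring.solve-∀

odd⇒double+1 : ∀ {m} → Odd m → ∃[ a ] m ≡ suc (a ℕ.* 2)
odd⇒double+1 {m} odd-m with halving m
... | even k = ⊥-elim (double%2≢1 k odd-m)
... | odd k  = k , refl


2+t≤h⇒K-h+2≤K-t : ∀ K h t → 2 ℕ.+ t ≤ h → + K ℤ.- + h ℤ.+ + 2 ℤ.≤ + K ℤ.- + t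
2+t≤h⇒K-h+2≤K-t K h t 2+t≤h with d , refl ← ℕₚ.m≤n⇒∃[o]m+o≡n 2+t≤h =
  subst (ℤ._≤ + K ℤ.- + t) (sym (identity (+ K) (+ t) (+ d))) (ℤₚ.i-j≤i (+ K ℤ.- + t) (+ d))
  where
  identity : ∀ K t d → K ℤ.- (+ 2 ℤ.+ t ℤ.+ d) ℤ.+ + 2 ≡ K ℤ.- t ℤ.- d
  identity = solve-∀

K-h+2≤K-t⇒2+t≤h : ∀ K h t → + K ℤ.- + h ℤ.+ + 2 ℤ.≤ + K ℤ.- + t → 2 ℕ.+ t ≤ h
K-h+2≤K-t⇒2+t≤h K h t le = ℤₚ.drop‿+≤+
  (subst₂ ℤ._≤_ (shift (+ K) (+ h) (+ t)) (shift′ (+ K) (+ h) (+ t)) (ℤₚ.+-monoˡ-≤ (+ h ℤ.+ + t ℤ.- + K) le))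
  where
  shift : ∀ K h t → K ℤ.- h ℤ.+ + 2 ℤ.+ (h ℤ.+ t ℤ.- K) ≡ + 2 ℤ.+ t
  shift = solve-∀
  shift′ : ∀ K h t → K ℤ.- t ℤ.+ (h ℤ.+ t ℤ.- K) ≡ h
  shift′ = solve-∀

i≤+n⇒∃[t]i≡n-t : ∀ {i} n → i ℤ.≤ + n → ∃[ t ] i ≡ + n ℤ.- + t
i≤+n⇒∃[t]i≡n-t {i} n i≤n = ℤ.∣ + n ℤ.- i ∣ , (begin
  i                         ≡⟨ identity i (+ n) ⟩
  + n ℤ.- (+ n ℤ.- i)       ≡⟨ cong (λ z → + n ℤ.- z) (ℤₚ.0≤i⇒+∣i∣≡i (ℤₚ.i≤j⇒0≤j-i i≤n)) ⟨
  + n ℤ.- + ℤ.∣ + n ℤ.- i ∣ ∎)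
  where
  open ≡-Reasoning
  identity : ∀ i n → i ≡ n ℤ.- (n ℤ.- i)
  identity = solve-∀



-- The checkerboard enumeration

checkerboard : ℕ → ℕ → ℤ
checkerboard K L with L % 2
... | 0 = + suc (L / 2)
... | _ = + K ℤ.- + (L / 2)

checkerboard-double : ∀ K k → checkerboard K (k ℕ.* 2) ≡ + suc k
checkerboard-double K k rewrite m*n%n≡0 k 2 ⦃ _ ⦄ | m*n/n≡m k 2 ⦃ _ ⦄ = refl

checkerboard-double+1 : ∀ K k → checkerboard K (suc (k ℕ.* 2)) ≡ + K ℤ.- + k
checkerboard-double+1 K k rewrite double+1%2 k | double+1/2 k = refl

checkerboard-face : ∀ K a L →
  checkerboard K L ℤ.+ checkerboard K (suc L)
    ℤ.+ checkerboard K (L ℕ.+ suc (a ℕ.* 2)) ℤ.+ checkerboard K (suc (L ℕ.+ suc (a ℕ.* 2)))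
    ≡ + (2 ℕ.* K ℕ.+ 3)
checkerboard-face K a L with halving L
... | even k
  rewrite double+double+1 k a
        | checkerboard-double K k | checkerboard-double+1 K k
        | checkerboard-double+1 K (k ℕ.+ a) | checkerboard-double K (suc (k ℕ.+ a))
        | ℕₚ.+-identityʳ K
  = identity (+ K) (+ k) (+ a)
  where
  identity : ∀ K k a → (+ 1 ℤ.+ k) ℤ.+ (K ℤ.- k) ℤ.+ (K ℤ.- (k ℤ.+ a)) ℤ.+ (+ 2 ℤ.+ (k ℤ.+ a))
                       ≡ K ℤ.+ K ℤ.+ + 3
  identity = solve-∀
... | odd k
  rewrite double+double+1 k a
        | checkerboard-double+1 K k | checkerboard-double K (suc k)
        | checkerboard-double K (suc (k ℕ.+ a)) | checkerboard-double+1 K (suc (k ℕ.+ a))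
        | ℕₚ.+-identityʳ K
  = identity (+ K) (+ k) (+ a)
  where
  identity : ∀ K k a → (K ℤ.- k) ℤ.+ (+ 2 ℤ.+ k) ℤ.+ (+ 2 ℤ.+ (k ℤ.+ a)) ℤ.+ (K ℤ.- (+ 1 ℤ.+ (k ℤ.+ a)))
                       ≡ K ℤ.+ K ℤ.+ + 3
  identity = solve-∀

-- An m × n grid with mn = 2h - 1 has the positions L with suc L < 2h.
checkerboard-range-even : ∀ K h L → L % 2 ≡ 0 → suc L < h ℕ.* 2 →
  (+ 1 ℤ.≤ checkerboard K L) × (checkerboard K L ℤ.≤ + h)
checkerboard-range-even K h L ev L<2h with halving L
... | odd k = ⊥-elim (double+1%2≢0 k ev)
... | even k rewrite checkerboard-double K k = +≤+ (s≤s z≤n) , +≤+ (ℕₚ.*-cancelʳ-≤ (suc k) h 2 L<2h)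

checkerboard-range-odd : ∀ K h L → L % 2 ≡ 1 → suc L < h ℕ.* 2 →
  (+ K ℤ.- + h ℤ.+ + 2 ℤ.≤ checkerboard K L) × (checkerboard K L ℤ.≤ + K)
checkerboard-range-odd K h L od L<2h with halving L
... | even k = ⊥-elim (double%2≢1 k od)
... | odd k rewrite checkerboard-double+1 K k =
  2+t≤h⇒K-h+2≤K-t K h k (ℕₚ.*-cancelʳ-< 2 (suc k) h L<2h) , ℤₚ.i-j≤i (+ K) (+ k)

checkerboard-onto-even : ∀ K h k → + 1 ℤ.≤ k → k ℤ.≤ + h →
  ∃[ L ] (L % 2 ≡ 0 × suc L < h ℕ.* 2 × checkerboard K L ≡ k)
checkerboard-onto-even K h (+ suc t) _ (+≤+ t<h) =
  t ℕ.* 2 , m*n%n≡0 t 2 , ℕₚ.*-monoˡ-≤ 2 t<h , checkerboard-double K t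
checkerboard-onto-even K h (+ zero) (+≤+ ()) _

checkerboard-onto-odd : ∀ K h k → + K ℤ.- + h ℤ.+ + 2 ℤ.≤ k → k ℤ.≤ + K →
  ∃[ L ] (L % 2 ≡ 1 × suc L < h ℕ.* 2 × checkerboard K L ≡ k)
checkerboard-onto-odd K h k lo k≤K with t , refl ← i≤+n⇒∃[t]i≡n-t K k≤K =
  suc (t ℕ.* 2) , double+1%2 t ,
  ℕₚ.≤-trans (ℕₚ.n≤1+n _) (ℕₚ.*-monoˡ-≤ 2 (K-h+2≤K-t⇒2+t≤h K h t lo)) ,
  checkerboard-double+1 K t

checkerboard-<-even : ∀ K s L → L % 2 ≡ 0 → 0 < s → checkerboard K L ℤ.< checkerboard K (L ℕ.+ s ℕ.* 2)
checkerboard-<-even K s L ev s>0 with halving L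
... | odd k = ⊥-elim (double+1%2≢0 k ev)
... | even k rewrite sym (ℕₚ.*-distribʳ-+ 2 k s) | checkerboard-double K k | checkerboard-double K (k ℕ.+ s) =
  +<+ (s≤s (ℕₚ.m<m+n k s>0))

checkerboard-<-odd : ∀ K s L → L % 2 ≡ 1 → 0 < s → checkerboard K (L ℕ.+ s ℕ.* 2) ℤ.< checkerboard K L
checkerboard-<-odd K s L od s>0 with halving L
... | even k = ⊥-elim (double%2≢1 k od)
... | odd k rewrite sym (ℕₚ.*-distribʳ-+ 2 k s) | checkerboard-double+1 K k | checkerboard-double+1 K (k ℕ.+ s) =
  ℤₚ.+-monoʳ-< (+ K) (ℤₚ.neg-mono-< (+<+ (ℕₚ.m<m+n k s>0)))

checkerboard-mirror-even : ∀ K h L L′ → L % 2 ≡ 0 → suc (suc (L ℕ.+ L′)) ≡ h ℕ.* 2 →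
  checkerboard K L ℤ.+ checkerboard K L′ ≡ + h ℤ.+ + 1
checkerboard-mirror-even K h L L′ ev L+L′+2≡2h with halving L | halving L′
... | odd k  | _     = ⊥-elim (double+1%2≢0 k ev)
... | even k | odd l =
  ⊥-elim (double≢double+1 h (suc (k ℕ.+ l)) (trans (sym L+L′+2≡2h) (cong (suc ∘ suc) (double+double+1 k l))))
... | even k | even l
  with refl ← ℕₚ.*-cancelʳ-≡ (suc (k ℕ.+ l)) h 2 (trans (cong (suc ∘ suc) (ℕₚ.*-distribʳ-+ 2 k l)) L+L′+2≡2h)
  rewrite checkerboard-double K k | checkerboard-double K l = identity (+ k) (+ l)
  where
  identity : ∀ k l → (+ 1 ℤ.+ k) ℤ.+ (+ 1 ℤ.+ l) ≡ (+ 1 ℤ.+ (k ℤ.+ l)) ℤ.+ + 1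
  identity = solve-∀

checkerboard-mirror-odd : ∀ K h L L′ → L % 2 ≡ 1 → suc (suc (L ℕ.+ L′)) ≡ h ℕ.* 2 →
  checkerboard K L ℤ.+ checkerboard K L′ ≡ + (2 ℕ.* K) ℤ.- + h ℤ.+ + 2
checkerboard-mirror-odd K h L L′ od L+L′+2≡2h with halving L | halving L′
... | even k | _      = ⊥-elim (double%2≢1 k od)
... | odd k  | even l =
  ⊥-elim (double≢double+1 h (suc (k ℕ.+ l)) (trans (sym L+L′+2≡2h) (cong (suc ∘ suc ∘ suc) (sym (ℕₚ.*-distribʳ-+ 2 k l)))))
... | odd k  | odd l
  with refl ← ℕₚ.*-cancelʳ-≡ (suc (suc (k ℕ.+ l))) h 2 (trans (cong (suc ∘ suc ∘ suc) (sym (double+double+1 k l))) L+L′+2≡2h)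
  rewrite checkerboard-double+1 K k | checkerboard-double+1 K l | ℕₚ.+-identityʳ K = identity (+ K) (+ k) (+ l)
  where
  identity : ∀ K k l → (K ℤ.- k) ℤ.+ (K ℤ.- l) ≡ K ℤ.+ K ℤ.- (+ 2 ℤ.+ (k ℤ.+ l)) ℤ.+ + 2
  identity = solve-∀


-- Column-major positions

index-parity : ∀ a i j → (suc i ℕ.+ suc j) % 2 ≡ (i ℕ.+ suc (a ℕ.* 2) ℕ.* j) % 2
index-parity a i j = begin
  (suc i ℕ.+ suc j) % 2                      ≡⟨ cong (_% 2) (shift i j) ⟩
  (i ℕ.+ j ℕ.+ 1 ℕ.* 2) % 2                  ≡⟨ [m+kn]%n≡m%n (i ℕ.+ j) 1 2 ⟩
  (i ℕ.+ j) % 2                              ≡⟨ [m+kn]%n≡m%n (i ℕ.+ j) (a ℕ.* j) 2 ⟨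
  (i ℕ.+ j ℕ.+ a ℕ.* j ℕ.* 2) % 2            ≡⟨ cong (_% 2) (expand a i j) ⟩
  (i ℕ.+ suc (a ℕ.* 2) ℕ.* j) % 2            ∎
  where
  open ≡-Reasoning
  shift : ∀ i j → suc i ℕ.+ suc j ≡ i ℕ.+ j ℕ.+ 1 ℕ.* 2
  shift = ℕ-Ring.solve-∀
  expand : ∀ a i j → i ℕ.+ j ℕ.+ a ℕ.* j ℕ.* 2 ≡ i ℕ.+ suc (a ℕ.* 2) ℕ.* j
  expand = ℕ-Ring.solve-∀

index-suc-col : ∀ m i j → i ℕ.+ m ℕ.* suc j ≡ i ℕ.+ m ℕ.* j ℕ.+ m
index-suc-col = ℕ-Ring.solve-∀

index-i+2 : ∀ m i j → i ℕ.+ 2 ℕ.+ m ℕ.* j ≡ i ℕ.+ m ℕ.* j ℕ.+ 1 ℕ.* 2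
index-i+2 = ℕ-Ring.solve-∀

index-j+2 : ∀ m i j → i ℕ.+ m ℕ.* (j ℕ.+ 2) ≡ i ℕ.+ m ℕ.* j ℕ.+ m ℕ.* 2
index-j+2 = ℕ-Ring.solve-∀

index-< : ∀ {m n i j} → i < m → j < n → i ℕ.+ m ℕ.* j < m ℕ.* n
index-< {m} {n} {i} {j} i<m j<n = begin-strict
  i ℕ.+ m ℕ.* j    <⟨ ℕₚ.+-monoˡ-< (m ℕ.* j) i<m ⟩
  m ℕ.+ m ℕ.* j    ≡⟨ ℕₚ.*-suc m j ⟨
  m ℕ.* suc j      ≤⟨ ℕₚ.*-monoʳ-≤ m j<n ⟩
  m ℕ.* n          ∎
  where open ℕₚ.≤-Reasoning

index-surjective : ∀ m n L .⦃ _ : ℕ.NonZero m ⦄ → L < m ℕ.* n →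
  ∃[ i ] ∃[ j ] (i < m × j < n × i ℕ.+ m ℕ.* j ≡ L)
index-surjective m n L L<mn =
  L % m , L / m , m%n<n L m , m<n*o⇒m/o<n (subst (L <_) (ℕₚ.*-comm m n) L<mn) ,
  trans (cong (L % m ℕ.+_) (ℕₚ.*-comm m (L / m))) (sym (m≡m%n+[m/n]*n L m))

index-mirror : ∀ {m n i j} → i < m → j < n →
  suc ((i ℕ.+ m ℕ.* j) ℕ.+ ((m ∸ suc i) ℕ.+ m ℕ.* (n ∸ suc j))) ≡ m ℕ.* n
index-mirror {m} {n} {i} {j} i<m j<n =
  subst₂ (λ m n → suc ((i ℕ.+ m ℕ.* j) ℕ.+ (r ℕ.+ m ℕ.* s)) ≡ m ℕ.* n)
         (ℕₚ.m+[n∸m]≡n i<m) (ℕₚ.m+[n∸m]≡n j<n) (identity i r j s)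
  where
  r = m ∸ suc i
  s = n ∸ suc j
  identity : ∀ i r j s → suc ((i ℕ.+ suc (i ℕ.+ r) ℕ.* j) ℕ.+ (r ℕ.+ suc (i ℕ.+ r) ℕ.* s))
                         ≡ suc (i ℕ.+ r) ℕ.* suc (j ℕ.+ s)
  identity = ℕ-Ring.solve-∀

hmn-odd : ∀ a b → suc (suc (a ℕ.* 2) ℕ.* suc (b ℕ.* 2)) ≡ hmn (suc (a ℕ.* 2)) (suc (b ℕ.* 2)) ℕ.* 2
hmn-odd a b = begin
  suc (m ℕ.* n)                 ≡⟨ ℕₚ.+-comm 1 (m ℕ.* n) ⟩
  m ℕ.* n ℕ.+ 1                 ≡⟨ mn+1≡ ⟩
  suc (a ℕ.+ m ℕ.* b) ℕ.* 2     ≡⟨ cong (ℕ._* 2) (trans (cong (_/ 2) mn+1≡) (m*n/n≡m (suc (a ℕ.+ m ℕ.* b)) 2)) ⟨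
  hmn m n ℕ.* 2                 ∎
  where
  open ≡-Reasoning
  m = suc (a ℕ.* 2)
  n = suc (b ℕ.* 2)
  expand : ∀ a b → suc (a ℕ.* 2) ℕ.* suc (b ℕ.* 2) ℕ.+ 1 ≡ suc (a ℕ.+ suc (a ℕ.* 2) ℕ.* b) ℕ.* 2
  expand = ℕ-Ring.solve-∀
  mn+1≡ : m ℕ.* n ℕ.+ 1 ≡ suc (a ℕ.+ m ℕ.* b) ℕ.* 2
  mn+1≡ = expand a b

module ColumnMajorCheckerboard (M N a b : ℕ) (x : Labeling)
  (x≡checkerboard : ∀ i j → x (suc i) (suc j) ≡ checkerboard (M ℕ.* N) (i ℕ.+ suc (a ℕ.* 2) ℕ.* j)) where

  private
    m = suc (a ℕ.* 2)
    n = suc (b ℕ.* 2)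
    K = M ℕ.* N
    h = hmn m n

    parity : ∀ {r} i j → (suc i ℕ.+ suc j) % 2 ≡ r → (i ℕ.+ m ℕ.* j) % 2 ≡ r
    parity i j = trans (sym (index-parity a i j))

    in-range : ∀ {i j} → i < m → j < n → suc (i ℕ.+ m ℕ.* j) < h ℕ.* 2
    in-range {i} {j} i<m j<n = subst (suc (suc (i ℕ.+ m ℕ.* j)) ≤_) (hmn-odd a b) (s≤s (index-< i<m j<n))

    in-grid : ∀ L → suc L < h ℕ.* 2 → ∃[ i ] ∃[ j ] (InGrid m n (suc i) (suc j) × i ℕ.+ m ℕ.* j ≡ L)
    in-grid L L<2h
      with i , j , i<m , j<n , e ← index-surjective m n L (ℕₚ.≤-pred (subst (suc (suc L) ≤_) (sym (hmn-odd a b)) L<2h))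
      = i , j , ((s≤s z≤n , i<m) , (s≤s z≤n , j<n)) , e

    -- the cell opposite (suc i, suc j), since suc m ∸ suc i reduces to m ∸ i
    mirror : ∀ {i j} → i < m → j < n →
      x (m ∸ i) (n ∸ j) ≡ checkerboard K ((m ∸ suc i) ℕ.+ m ℕ.* (n ∸ suc j))
    mirror {i} {j} i<m j<n =
      trans (cong₂ x (ℕₚ.+-∸-assoc 1 i<m) (ℕₚ.+-∸-assoc 1 j<n)) (x≡checkerboard (m ∸ suc i) (n ∸ suc j))

    mirror-sum : ∀ {i j} → i < m → j < n →
      suc (suc ((i ℕ.+ m ℕ.* j) ℕ.+ ((m ∸ suc i) ℕ.+ m ℕ.* (n ∸ suc j)))) ≡ h ℕ.* 2
    mirror-sum i<m j<n = trans (cong suc (index-mirror i<m j<n)) (hmn-odd a b)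

  face : ∀ i j → 1 ≤ i → i ≤ m ∸ 1 → 1 ≤ j → j ≤ n ∸ 1 →
    x i j ℤ.+ x (suc i) j ℤ.+ x i (suc j) ℤ.+ x (suc i) (suc j) ≡ + (2 ℕ.* K ℕ.+ 3)
  face (suc i) (suc j) _ _ _ _
    rewrite x≡checkerboard i j | x≡checkerboard (suc i) j | x≡checkerboard i (suc j) | x≡checkerboard (suc i) (suc j)
    = trans (cong (λ L′ → checkerboard K L ℤ.+ checkerboard K (suc L) ℤ.+ checkerboard K L′ ℤ.+ checkerboard K (suc L′))
                  (index-suc-col m i j))
            (checkerboard-face K a L)
    where L = i ℕ.+ m ℕ.* j

  evenIn : ∀ i j → InGrid m n i j → Even (i ℕ.+ j) → (+ 1 ℤ.≤ x i j) × (x i j ℤ.≤ + h)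
  evenIn (suc i) (suc j) ((_ , i<m) , (_ , j<n)) e rewrite x≡checkerboard i j =
    checkerboard-range-even K h (i ℕ.+ m ℕ.* j) (parity i j e) (in-range i<m j<n)

  oddIn : ∀ i j → InGrid m n i j → Odd (i ℕ.+ j) → (+ K ℤ.- + h ℤ.+ + 2 ℤ.≤ x i j) × (x i j ℤ.≤ + K)
  oddIn (suc i) (suc j) ((_ , i<m) , (_ , j<n)) o rewrite x≡checkerboard i j =
    checkerboard-range-odd K h (i ℕ.+ m ℕ.* j) (parity i j o) (in-range i<m j<n)

  evenOnto : ∀ k → + 1 ℤ.≤ k → k ℤ.≤ + h → ∃[ i ] ∃[ j ] (InGrid m n i j × Even (i ℕ.+ j) × x i j ≡ k)
  evenOnto k lo hi
    with L , e , L<2h , cb≡k ← checkerboard-onto-even K h k lo hi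
    with i , j , g , refl ← in-grid L L<2h
    = suc i , suc j , g , trans (index-parity a i j) e , trans (x≡checkerboard i j) cb≡k

  oddOnto : ∀ k → + K ℤ.- + h ℤ.+ + 2 ℤ.≤ k → k ℤ.≤ + K → ∃[ i ] ∃[ j ] (InGrid m n i j × Odd (i ℕ.+ j) × x i j ≡ k)
  oddOnto k lo hi
    with L , o , L<2h , cb≡k ← checkerboard-onto-odd K h k lo hi
    with i , j , g , refl ← in-grid L L<2h
    = suc i , suc j , g , trans (index-parity a i j) o , trans (x≡checkerboard i j) cb≡k

  symEven : ∀ i j → InGrid m n i j → Even (i ℕ.+ j) → x i j ℤ.+ x (suc m ∸ i) (suc n ∸ j) ≡ + h ℤ.+ + 1
  symEven (suc i) (suc j) ((_ , i<m) , (_ , j<n)) e =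
    trans (cong₂ ℤ._+_ (x≡checkerboard i j) (mirror i<m j<n))
          (checkerboard-mirror-even K h (i ℕ.+ m ℕ.* j) ((m ∸ suc i) ℕ.+ m ℕ.* (n ∸ suc j)) (parity i j e) (mirror-sum i<m j<n))

  symOdd : ∀ i j → InGrid m n i j → Odd (i ℕ.+ j) → x i j ℤ.+ x (suc m ∸ i) (suc n ∸ j) ≡ + (2 ℕ.* K) ℤ.- + h ℤ.+ + 2
  symOdd (suc i) (suc j) ((_ , i<m) , (_ , j<n)) o =
    trans (cong₂ ℤ._+_ (x≡checkerboard i j) (mirror i<m j<n))
          (checkerboard-mirror-odd K h (i ℕ.+ m ℕ.* j) ((m ∸ suc i) ℕ.+ m ℕ.* (n ∸ suc j)) (parity i j o) (mirror-sum i<m j<n))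

  down2-even : ∀ i j → Even (suc i ℕ.+ suc j) → x (suc i) (suc j) ℤ.< x (suc i ℕ.+ 2) (suc j)
  down2-even i j e rewrite x≡checkerboard i j | x≡checkerboard (i ℕ.+ 2) j | index-i+2 m i j =
    checkerboard-<-even K 1 (i ℕ.+ m ℕ.* j) (parity i j e) (s≤s z≤n)

  down2-odd : ∀ i j → Odd (suc i ℕ.+ suc j) → x (suc i ℕ.+ 2) (suc j) ℤ.< x (suc i) (suc j)
  down2-odd i j o rewrite x≡checkerboard i j | x≡checkerboard (i ℕ.+ 2) j | index-i+2 m i j =
    checkerboard-<-odd K 1 (i ℕ.+ m ℕ.* j) (parity i j o) (s≤s z≤n)

  right2-even : ∀ i j → Even (suc i ℕ.+ suc j) → x (suc i) (suc j) ℤ.< x (suc i) (suc j ℕ.+ 2)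
  right2-even i j e rewrite x≡checkerboard i j | x≡checkerboard i (j ℕ.+ 2) | index-j+2 m i j =
    checkerboard-<-even K m (i ℕ.+ m ℕ.* j) (parity i j e) (s≤s z≤n)

  right2-odd : ∀ i j → Odd (suc i ℕ.+ suc j) → x (suc i) (suc j ℕ.+ 2) ℤ.< x (suc i) (suc j)
  right2-odd i j o rewrite x≡checkerboard i j | x≡checkerboard i (j ℕ.+ 2) | index-j+2 m i j =
    checkerboard-<-odd K m (i ℕ.+ m ℕ.* j) (parity i j o) (s≤s z≤n)

  isPartialBicentrallyBalanced : PartialBicentrallyBalanced M N m n x
  isPartialBicentrallyBalanced = record
    { face = face ; evenIn = evenIn ; evenOnto = evenOnto ; oddIn = oddIn ; oddOnto = oddOnto
    ; symEven = symEven ; symOdd = symOdd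
    ; colEven = λ { (suc i) _ _ → down2-even i (half n) }
    ; colOdd  = λ { (suc i) _ _ → down2-odd i (half n) }
    ; rowEven = λ { (suc j) _ _ → right2-even (half m) j }
    ; rowOdd  = λ { (suc j) _ _ → right2-odd (half m) j }
    }


-- Transposition

+-comm-%2 : ∀ {r} i j → (i ℕ.+ j) % 2 ≡ r → (j ℕ.+ i) % 2 ≡ r
+-comm-%2 i j = trans (cong (_% 2) (ℕₚ.+-comm j i))

hmn-comm : ∀ m n → hmn m n ≡ hmn n m
hmn-comm m n = cong (λ k → (k ℕ.+ 1) / 2) (ℕₚ.*-comm m n)

PBB-transpose : ∀ {M N m n x} → PartialBicentrallyBalanced N M n m x →
  PartialBicentrallyBalanced M N m n (λ i j → x j i)
PBB-transpose {M} {N} {m} {n} {x} P = record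
  { face     = λ i j 1≤i i<m 1≤j j<n →
      trans (swap-middle (x j i) (x j (suc i)) (x (suc j) i) (x (suc j) (suc i)))
            (trans (P.face j i 1≤j j<n 1≤i i<m) (cong (λ K → + (2 ℕ.* K ℕ.+ 3)) NM≡MN))
  ; evenIn   = λ i j g e → subst (λ h → (+ 1 ℤ.≤ x j i) × (x j i ℤ.≤ + h)) hnm≡hmn
      (P.evenIn j i (swap g) (+-comm-%2 i j e))
  ; evenOnto = λ k lo hi → transposed (P.evenOnto k lo (subst (λ h → k ℤ.≤ + h) (sym hnm≡hmn) hi))
  ; oddIn    = λ i j g o → subst₂ (λ K h → (+ K ℤ.- + h ℤ.+ + 2 ℤ.≤ x j i) × (x j i ℤ.≤ + K)) NM≡MN hnm≡hmn
      (P.oddIn j i (swap g) (+-comm-%2 i j o))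
  ; oddOnto  = λ k lo hi → transposed (P.oddOnto k
      (subst₂ (λ K h → + K ℤ.- + h ℤ.+ + 2 ℤ.≤ k) (sym NM≡MN) (sym hnm≡hmn) lo)
      (subst (λ K → k ℤ.≤ + K) (sym NM≡MN) hi))
  ; symEven  = λ i j g e → trans (P.symEven j i (swap g) (+-comm-%2 i j e)) (cong (λ h → + h ℤ.+ + 1) hnm≡hmn)
  ; symOdd   = λ i j g o → trans (P.symOdd j i (swap g) (+-comm-%2 i j o))
      (cong₂ (λ K h → + (2 ℕ.* K) ℤ.- + h ℤ.+ + 2) NM≡MN hnm≡hmn)
  ; colEven  = λ i 1≤i i≤ e → P.rowEven i 1≤i i≤ (+-comm-%2 i _ e)
  ; colOdd   = λ i 1≤i i≤ o → P.rowOdd i 1≤i i≤ (+-comm-%2 i _ o)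
  ; rowEven  = λ j 1≤j j≤ e → P.colEven j 1≤j j≤ (+-comm-%2 _ j e)
  ; rowOdd   = λ j 1≤j j≤ o → P.colOdd j 1≤j j≤ (+-comm-%2 _ j o)
  }
  where
  module P = PartialBicentrallyBalanced P
  NM≡MN = ℕₚ.*-comm N M
  hnm≡hmn = hmn-comm n m
  swap-middle : ∀ w x y z → w ℤ.+ x ℤ.+ y ℤ.+ z ≡ w ℤ.+ y ℤ.+ x ℤ.+ z
  swap-middle = solve-∀
  transposed : ∀ {r k} → ∃[ j ] ∃[ i ] (InGrid n m j i × (j ℕ.+ i) % 2 ≡ r × x j i ≡ k) →
    ∃[ i ] ∃[ j ] (InGrid m n i j × (i ℕ.+ j) % 2 ≡ r × x j i ≡ k)
  transposed (j , i , g , p , e) = i , j , swap g , +-comm-%2 j i p , e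


hf-double+1 : ∀ p → hf (suc (p ℕ.* 2)) ≡ suc p
hf-double+1 p = trans (cong (_/ 2) (ℕₚ.+-comm (suc (p ℕ.* 2)) 1)) (m*n/n≡m (suc p) 2)

hf-double : ∀ p → hf (suc p ℕ.* 2) ≡ suc p
hf-double p = trans (cong (_/ 2) (ℕₚ.+-comm (suc p ℕ.* 2) 1)) (double+1/2 (suc p))

+[1+2a] : ∀ a → + suc (a ℕ.* 2) ≡ + 1 ℤ.+ (+ a ℤ.+ + a)
+[1+2a] a = cong (λ z → + suc z) (trans (ℕₚ.*-comm a 2) (cong (a ℕ.+_) (ℕₚ.+-identityʳ a)))

+[u+m*q] : ∀ u m q → + u ℤ.+ + m ℤ.* + q ≡ + (u ℕ.+ m ℕ.* q)
+[u+m*q] u m q = cong (λ z → + u ℤ.+ z) (sym (ℤₚ.pos-* m q))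

index-even-even : ∀ a p q → p ℕ.* 2 ℕ.+ suc (a ℕ.* 2) ℕ.* (q ℕ.* 2) ≡ (p ℕ.+ suc (a ℕ.* 2) ℕ.* q) ℕ.* 2
index-even-even = ℕ-Ring.solve-∀

index-odd-even : ∀ a p q → suc (p ℕ.* 2 ℕ.+ suc (a ℕ.* 2) ℕ.* (q ℕ.* 2)) ≡ suc ((p ℕ.+ suc (a ℕ.* 2) ℕ.* q) ℕ.* 2)
index-odd-even = ℕ-Ring.solve-∀

index-even-odd : ∀ a p q → p ℕ.* 2 ℕ.+ suc (a ℕ.* 2) ℕ.* suc (q ℕ.* 2) ≡ suc ((p ℕ.+ a ℕ.+ suc (a ℕ.* 2) ℕ.* q) ℕ.* 2)
index-even-odd = ℕ-Ring.solve-∀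

index-odd-odd : ∀ a p q → suc (p ℕ.* 2 ℕ.+ suc (a ℕ.* 2) ℕ.* suc (q ℕ.* 2)) ≡ suc (p ℕ.+ a ℕ.+ suc (a ℕ.* 2) ℕ.* q) ℕ.* 2
index-odd-odd = ℕ-Ring.solve-∀

module _ (M N a n : ℕ) where
  private
    m = suc (a ℕ.* 2)
    K = M ℕ.* N
  open ≡-Reasoning

  HALL-checkerboard : ∀ i j → HALL M N m n (suc i) (suc j) ≡ checkerboard K (i ℕ.+ m ℕ.* j)
  HALL-checkerboard i j with halving i | halving j
  ... | even p | even q rewrite double+1%2 p | double+1%2 q | hf-double+1 p | hf-double+1 q = begin
    + m ℤ.* (+ suc q ℤ.- + 1) ℤ.+ + suc p          ≡⟨ identity (+ m) (+ p) (+ q) ⟩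
    + 1 ℤ.+ (+ p ℤ.+ + m ℤ.* + q)                  ≡⟨ cong (λ z → + 1 ℤ.+ z) (+[u+m*q] p m q) ⟩
    + suc (p ℕ.+ m ℕ.* q)                          ≡⟨ checkerboard-double K _ ⟨
    checkerboard K ((p ℕ.+ m ℕ.* q) ℕ.* 2)         ≡⟨ cong (checkerboard K) (index-even-even a p q) ⟨
    checkerboard K (p ℕ.* 2 ℕ.+ m ℕ.* (q ℕ.* 2))   ∎
    where
    identity : ∀ m p q → m ℤ.* ((+ 1 ℤ.+ q) ℤ.- + 1) ℤ.+ (+ 1 ℤ.+ p) ≡ + 1 ℤ.+ (p ℤ.+ m ℤ.* q)
    identity = solve-∀
  ... | odd p | even q rewrite m*n%n≡0 (suc p) 2 ⦃ _ ⦄ | double+1%2 q | hf-double p | hf-double+1 q = begin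
    + K ℤ.+ + m ℤ.* (+ 1 ℤ.- + suc q) ℤ.+ + 1 ℤ.- + suc p  ≡⟨ identity (+ K) (+ m) (+ p) (+ q) ⟩
    + K ℤ.- (+ p ℤ.+ + m ℤ.* + q)                          ≡⟨ cong (λ z → + K ℤ.- z) (+[u+m*q] p m q) ⟩
    + K ℤ.- + (p ℕ.+ m ℕ.* q)                              ≡⟨ checkerboard-double+1 K (p ℕ.+ m ℕ.* q) ⟨
    checkerboard K (suc ((p ℕ.+ m ℕ.* q) ℕ.* 2))           ≡⟨ cong (checkerboard K) (index-odd-even a p q) ⟨
    checkerboard K (suc (p ℕ.* 2 ℕ.+ m ℕ.* (q ℕ.* 2)))     ∎
    where
    identity : ∀ K m p q → K ℤ.+ m ℤ.* (+ 1 ℤ.- (+ 1 ℤ.+ q)) ℤ.+ + 1 ℤ.- (+ 1 ℤ.+ p) ≡ K ℤ.- (p ℤ.+ m ℤ.* q)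
    identity = solve-∀
  ... | even p | odd q rewrite double+1%2 p | m*n%n≡0 (suc q) 2 ⦃ _ ⦄ | hf-double+1 p | hf-double q | double+1/2 a = begin
    + K ℤ.- + m ℤ.* + suc q ℤ.+ + suc a ℤ.+ + 1 ℤ.- + suc p  ≡⟨ identity (+ K) (+ m) (+ a) (+ p) (+ q) (+[1+2a] a) ⟩
    + K ℤ.- (+ (p ℕ.+ a) ℤ.+ + m ℤ.* + q)                    ≡⟨ cong (λ z → + K ℤ.- z) (+[u+m*q] (p ℕ.+ a) m q) ⟩
    + K ℤ.- + (p ℕ.+ a ℕ.+ m ℕ.* q)                          ≡⟨ checkerboard-double+1 K (p ℕ.+ a ℕ.+ m ℕ.* q) ⟨
    checkerboard K (suc ((p ℕ.+ a ℕ.+ m ℕ.* q) ℕ.* 2))       ≡⟨ cong (checkerboard K) (index-even-odd a p q) ⟨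
    checkerboard K (p ℕ.* 2 ℕ.+ m ℕ.* suc (q ℕ.* 2))         ∎
    where
    identity : ∀ K m a p q → m ≡ + 1 ℤ.+ (a ℤ.+ a) →
      K ℤ.- m ℤ.* (+ 1 ℤ.+ q) ℤ.+ (+ 1 ℤ.+ a) ℤ.+ + 1 ℤ.- (+ 1 ℤ.+ p) ≡ K ℤ.- (p ℤ.+ a ℤ.+ m ℤ.* q)
    identity K _ a p q refl = solve (K ∷ a ∷ p ∷ q ∷ [])
  ... | odd p | odd q rewrite m*n%n≡0 (suc p) 2 ⦃ _ ⦄ | m*n%n≡0 (suc q) 2 ⦃ _ ⦄ | hf-double p | hf-double q | double+1/2 a = begin
    + m ℤ.* (+ suc q ℤ.- + 1) ℤ.+ + suc a ℤ.+ + suc p        ≡⟨ identity (+ m) (+ a) (+ p) (+ q) (+[1+2a] a) ⟩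
    + 2 ℤ.+ (+ (p ℕ.+ a) ℤ.+ + m ℤ.* + q)                    ≡⟨ cong (λ z → + 2 ℤ.+ z) (+[u+m*q] (p ℕ.+ a) m q) ⟩
    + suc (suc (p ℕ.+ a ℕ.+ m ℕ.* q))                       ≡⟨ checkerboard-double K _ ⟨
    checkerboard K (suc (p ℕ.+ a ℕ.+ m ℕ.* q) ℕ.* 2)        ≡⟨ cong (checkerboard K) (index-odd-odd a p q) ⟨
    checkerboard K (suc (p ℕ.* 2 ℕ.+ m ℕ.* suc (q ℕ.* 2)))  ∎
    where
    identity : ∀ m a p q → m ≡ + 1 ℤ.+ (a ℤ.+ a) →
      m ℤ.* ((+ 1 ℤ.+ q) ℤ.- + 1) ℤ.+ (+ 1 ℤ.+ a) ℤ.+ (+ 1 ℤ.+ p) ≡ + 2 ℤ.+ (p ℤ.+ a ℤ.+ m ℤ.* q)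
    identity _ a p q refl = solve (a ∷ p ∷ q ∷ [])

VALL-transpose : ∀ M N m n i j → VALL M N m n i j ≡ HALL N M n m j i
VALL-transpose M N m n i j with halving i | halving j
... | even p | even q rewrite m*n%n≡0 p 2 ⦃ _ ⦄ | m*n%n≡0 q 2 ⦃ _ ⦄ = refl
... | even p | odd q  rewrite m*n%n≡0 p 2 ⦃ _ ⦄ | double+1%2 q | ℕₚ.*-comm M N = refl
... | odd p  | even q rewrite double+1%2 p | m*n%n≡0 q 2 ⦃ _ ⦄ | ℕₚ.*-comm M N = refl
... | odd p  | odd q  rewrite double+1%2 p | double+1%2 q = refl

HALL-isPBB : ∀ M N a b →
  PartialBicentrallyBalanced M N (suc (a ℕ.* 2)) (suc (b ℕ.* 2)) (HALL M N (suc (a ℕ.* 2)) (suc (b ℕ.* 2)))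
HALL-isPBB M N a b =
  ColumnMajorCheckerboard.isPartialBicentrallyBalanced M N a b _ (HALL-checkerboard M N a (suc (b ℕ.* 2)))

VALL-isPBB : ∀ M N a b →
  PartialBicentrallyBalanced M N (suc (a ℕ.* 2)) (suc (b ℕ.* 2)) (VALL M N (suc (a ℕ.* 2)) (suc (b ℕ.* 2)))
VALL-isPBB M N a b = PBB-transpose
  (ColumnMajorCheckerboard.isPartialBicentrallyBalanced N M b a (λ j i → VALL M N m n i j)
    (λ j i → trans (VALL-transpose M N m n (suc i) (suc j)) (HALL-checkerboard N M b m j i)))
  where
  m = suc (a ℕ.* 2)
  n = suc (b ℕ.* 2)

theorem35 : (m n M N : ℕ) → Odd m → Odd n → Odd M → Odd N →
    3 ≤ m → 3 ≤ n → m ≤ M → n ≤ N →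
    PartialBicentrallyBalanced M N m n (HALL M N m n)
      × PartialBicentrallyBalanced M N m n (VALL M N m n)
theorem35 m n M N odd-m odd-n _ _ _ _ _ _
  with a , refl ← odd⇒double+1 {m} odd-m
     | b , refl ← odd⇒double+1 {n} odd-n
  = HALL-isPBB M N a b , VALL-isPBB M N a b
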